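{- Let $k\ge 2$ and let $B_k$ be the binomial tree with $2^{k-1}$ vertices. Then $cfc(B_k)=k-1$.
   Context: The rooted binomial tree $B_k$ is defined recursively: $B_1$ is a single vertex (its root); for $k>1$, $B_k$ consists of two disjoint copies of $B_{k-1}$ together with an edge joining their roots, the root of $B_k$ being the root of the first copy. For an edge-colored graph, a path is conflict-free if some color occurs on exactly one of its edges; $cfc(G)$ is the minimum number of colors in an edge-coloring of the connected graph $G$ in which every pair of distinct vertices is joined by a conflict-free path. -}

module Defs where

open import Data.Nat using (ℕ; zero; suc; _≤_; _≥_)
open import Data.Fin using (Fin)
open import Data.Fin.Properties using () renaming (_≟_ to _≟F_)
open import Data.Unit using (⊤; tt)
open import Data.Sum using (_⊎_; inj₁; inj₂)
open import Data.Product using (Σ; ∃; _×_; _,_)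
open import Data.List using (List; []; _∷_; length; filter; map)
open import Data.List.Relation.Unary.Unique.Propositional using (Unique)
open import Relation.Binary.PropositionalEquality using (_≡_; _≢_)
open import Relation.Nullary using (¬_)

-- Binomial tree B_k, indexed by n = k - 1 (so BVert n is the vertex set of B_{n+1}).  B_{n+2} : two disjoint copies of B_{n+1}
-- (inj₁ = first copy, inj₂ = second copy) plus an edge joining their roots.
BVert : ℕ → Set
BVert zero    = ⊤
BVert (suc n) = BVert n ⊎ BVert n

root : (n : ℕ) → BVert n
root zero    = tt
root (suc n) = inj₁ (root n)

data BEdge : ℕ → Set where
  inL    : ∀ {n} → BEdge n → BEdge (suc n)
  inR    : ∀ {n} → BEdge n → BEdge (suc n)
  bridge : ∀ {n} → BEdge (suc n)

ends : ∀ {n} → BEdge n → BVert n × BVert n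
ends (inL e) with ends e
... | (a , b) = inj₁ a , inj₁ b
ends (inR e) with ends e
... | (a , b) = inj₂ a , inj₂ b
ends {suc n} bridge = inj₁ (root n) , inj₂ (root n)

data Joins {n : ℕ} (e : BEdge n) (x y : BVert n) : Set where
  fwd : ends e ≡ (x , y) → Joins e x y
  bwd : ends e ≡ (y , x) → Joins e x y

-- A walk from x to y given by its list of vertices and list of edges:
-- IsWalk x vs es y means x = v0, vs = [v1,...,vm] with vm = y and
-- es = [e1,...,em] with e_i joining v_{i-1} and v_i.
data IsWalk {n : ℕ} : BVert n → List (BVert n) → List (BEdge n) → BVert n → Set where
  stop : ∀ {x} → IsWalk x [] [] x
  step : ∀ {x z y vs es} (e : BEdge n) → Joins e x z →
         IsWalk z vs es y → IsWalk x (z ∷ vs) (e ∷ es) y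

IsPath : ∀ {n} → BVert n → List (BEdge n) → BVert n → Set
IsPath {n} x es y = Σ (List (BVert n)) λ vs → IsWalk x vs es y × Unique (x ∷ vs)

countColor : ∀ {n c} → (BEdge n → Fin c) → Fin c → List (BEdge n) → ℕ
countColor col i es = length (filter (λ e → col e ≟F i) es)

ConflictFree : ∀ {n c} → (BEdge n → Fin c) → List (BEdge n) → Set
ConflictFree {c = c} col es = Σ (Fin c) λ i → countColor col i es ≡ 1

IsCFCColoring : ∀ {n c} → (BEdge n → Fin c) → Set
IsCFCColoring {n} col =
  (x y : BVert n) → x ≢ y →
  Σ (List (BEdge n)) λ es → IsPath x es y × ConflictFree col es

CFCColorable : ℕ → ℕ → Set
CFCColorable n c = Σ (BEdge n → Fin c) IsCFCColoring

CfcEq : ℕ → ℕ → Set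
CfcEq n m = CFCColorable n m × ((c : ℕ) → CFCColorable n c → m ≤ c)

module Submission where

-- Orienting every edge from its parent end to its child end turns B_k into
-- a rooted tree: depth grows by one along each edge and every non-root vertex
-- has exactly one parent edge.  A path whose first step goes down can never
-- turn up again, so it descends all the way.  Hence the only path between two
-- children of the root is the two-edge path through the root.
--
-- Lower bound: the root has n children, and the path between any two of
-- them is conflict-free only if its two root edges have different colours.
-- So a conflict-free colouring is injective on the n root edges.
--
-- Upper bound: colour the bridge that creates B_{m+2} from two copies of
-- B_{m+1} with colour m.  Inside a copy we reuse a conflict-free path of the
-- copy; between the copies we go through both roots and the bridge, whose
-- colour is used nowhere else in the graph.

open import Defs
open import Data.Nat using (ℕ; zero; suc; _+_; _≤_; _≥_; _∸_)
open import Data.Nat.Properties using (+-suc; +-comm)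
open import Data.Fin using (Fin; inject₁; fromℕ) renaming (zero to fzero; suc to fsuc)
open import Data.Fin.Properties using (fromℕ≢inject₁; inject₁-injective; injective⇒≤)
  renaming (_≟_ to _≟F_)
open import Data.Unit using (tt)
open import Data.Empty using (⊥-elim)
open import Function using (_∘′_)
open import Data.Sum using (_⊎_; inj₁; inj₂)
open import Data.Sum.Properties using (inj₁-injective; inj₂-injective)
open import Data.Product using (Σ; _×_; _,_; proj₁; proj₂)
import Data.Product as Product
open import Data.Product.Properties using (,-injective)
open import Data.List using (List; []; _∷_; _++_; length; filter; map)
open import Data.List.Properties using (filter-++; filter-none; filter-accept; length-++)
open import Data.List.Relation.Unary.All using (All; []; _∷_; universal)
open import Data.List.Relation.Unary.All.Properties using () renaming (map⁺ to All-map⁺)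
open import Data.List.Relation.Unary.AllPairs using ([]; _∷_)
open import Data.List.Relation.Unary.Unique.Propositional using (Unique)
import Data.List.Relation.Unary.Unique.Propositional.Properties as Unique
open import Data.List.Relation.Binary.Disjoint.Propositional using (Disjoint)
open import Data.List.Membership.Propositional.Properties using (∈-map⁻)
open import Relation.Binary.PropositionalEquality
open import Relation.Nullary using (¬_; yes; no; contradiction)

-- The tree structure of B_{n+1}

parent child : ∀ {n} → BEdge n → BVert n
parent (inL e)       = inj₁ (parent e)
parent (inR e)       = inj₂ (parent e)
parent {suc n} bridge = inj₁ (root n)

child (inL e)       = inj₁ (child e)
child (inR e)       = inj₂ (child e)
child {suc n} bridge = inj₂ (root n)

ends-parent-child : ∀ {n} (e : BEdge n) → ends e ≡ (parent e , child e)
ends-parent-child (inL e) = cong (Product.map inj₁ inj₁) (ends-parent-child e)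
ends-parent-child (inR e) = cong (Product.map inj₂ inj₂) (ends-parent-child e)
ends-parent-child bridge  = refl

-- The depth of a vertex is the number of times it lies in a second copy;
-- it is its distance from the root.
depth : ∀ {n} → BVert n → ℕ
depth {zero}  tt       = 0
depth {suc n} (inj₁ x) = depth x
depth {suc n} (inj₂ x) = suc (depth x)

depth-root : ∀ n → depth (root n) ≡ 0
depth-root zero    = refl
depth-root (suc n) = depth-root n

depth-child : ∀ {n} (e : BEdge n) → depth (child e) ≡ suc (depth (parent e))
depth-child (inL e) = depth-child e
depth-child (inR e) = cong suc (depth-child e)
depth-child bridge  = refl

root-not-child : ∀ {n} (e : BEdge n) → child e ≢ root n
root-not-child {n} e c≡r with trans (sym (depth-child e)) (trans (cong depth c≡r) (depth-root n))
... | ()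

child-injective : ∀ {n} {e e′ : BEdge n} → child e ≡ child e′ → e ≡ e′
child-injective {e = inL e}  {inL e′}  p = cong inL (child-injective (inj₁-injective p))
child-injective {e = inR e}  {inR e′}  p = cong inR (child-injective (inj₂-injective p))
child-injective {e = inR e}  {bridge}  p = ⊥-elim (root-not-child e (inj₂-injective p))
child-injective {e = bridge} {inR e′}  p = ⊥-elim (root-not-child e′ (sym (inj₂-injective p)))
child-injective {e = bridge} {bridge}  p = refl
child-injective {e = inL e}  {inR e′}  ()
child-injective {e = inL e}  {bridge}  ()
child-injective {e = inR e}  {inL e′}  ()
child-injective {e = bridge} {inL e′}  ()

Down : ∀ {n} → BEdge n → BVert n → BVert n → Set
Down e x z = parent e ≡ x × child e ≡ z

step-direction : ∀ {n} {e : BEdge n} {x z} → Joins e x z → Down e x z ⊎ Down e z x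
step-direction {e = e} (fwd p) = inj₁ (,-injective (trans (sym (ends-parent-child e)) p))
step-direction {e = e} (bwd p) = inj₂ (,-injective (trans (sym (ends-parent-child e)) p))

-- A path whose first step goes down from x keeps going down: turning up at
-- some vertex would reuse its unique parent edge and revisit a vertex.
descent : ∀ {n} {x z y : BVert n} {vs es} {e : BEdge n} → Down e x z →
          IsWalk z vs es y → Unique (x ∷ z ∷ vs) → depth y ≡ depth x + length (e ∷ es)
descent {x = x} {e = e} (refl , refl) stop _ = trans (depth-child e) (+-comm 1 (depth x))
descent {x = x} {y = y} {e = e} (refl , refl) (step {es = es} e′ j rest) ((_ ∷ x≢w ∷ _) ∷ uniq)
  with step-direction j
... | inj₁ down = begin
  depth y                                      ≡⟨ descent down rest uniq ⟩
  depth (child e) + length (e′ ∷ es)           ≡⟨ cong (_+ length (e′ ∷ es)) (depth-child e) ⟩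
  suc (depth x + length (e′ ∷ es))             ≡⟨ sym (+-suc (depth x) (length (e′ ∷ es))) ⟩
  depth x + length (e ∷ e′ ∷ es)               ∎
  where open ≡-Reasoning
... | inj₂ (parent≡w , child≡) = contradiction
  (trans (cong parent (child-injective {e = e} (sym child≡))) parent≡w) x≢w

-- Lower bound

depth-below-root : ∀ {n} {e : BEdge n} {v} → Down e (root n) v → depth v ≡ 1
depth-below-root {n} {e} (parent≡root , refl) =
  trans (depth-child e) (cong suc (trans (cong depth parent≡root) (depth-root n)))

-- A path from the root to a child v of the root is the single edge down to v:
-- it cannot go up, and any second downward step would end at depth two.
path-from-root-to-child : ∀ {n} {v : BVert n} {vs es} {e : BEdge n} → Down e (root n) v →
                          IsWalk (root n) vs es v → Unique (root n ∷ vs) → es ≡ e ∷ []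
path-from-root-to-child {e = e} down-e stop _ = ⊥-elim (root-not-child e (proj₂ down-e))
path-from-root-to-child {n} down-e (step e′ j rest) uniq with step-direction j
... | inj₂ (_ , child≡root) = ⊥-elim (root-not-child e′ child≡root)
... | inj₁ down with rest
...   | stop = cong (_∷ []) (child-injective (trans (proj₂ down) (sym (proj₂ down-e))))
...   | rest′@(step _ _ _) = contradiction
  (trans (sym (depth-below-root down-e))
         (trans (descent down rest′ uniq) (cong₂ _+_ (depth-root n) refl)))
  λ ()

-- The only path between two distinct children u, v of the root is
-- u – root – v: starting downward from u would end at depth ≥ 2, so the
-- first step climbs u's parent edge to the root.
path-between-root-children : ∀ {n} {u v : BVert n} {vs es} {e₁ e₂ : BEdge n} →
  Down e₁ (root n) u → Down e₂ (root n) v → u ≢ v →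
  IsWalk u vs es v → Unique (u ∷ vs) → es ≡ e₁ ∷ e₂ ∷ []
path-between-root-children _ _ u≢v stop _ = ⊥-elim (u≢v refl)
path-between-root-children down₁ down₂ _ (step e j rest) uniq with step-direction j
... | inj₁ down = contradiction
  (trans (sym (depth-below-root down₂))
         (trans (descent down rest uniq) (cong₂ _+_ (depth-below-root down₁) refl)))
  λ ()
... | inj₂ (parent≡z , child≡u) with child-injective (trans child≡u (sym (proj₂ down₁)))
...   | refl with trans (sym parent≡z) (proj₁ down₁)
...     | refl = cong (_ ∷_) (path-from-root-to-child down₂ rest (Unique-tail uniq))
  where
  Unique-tail : ∀ {A : Set} {a : A} {as} → Unique (a ∷ as) → Unique as
  Unique-tail (_ ∷ u) = u

root-edge : (n : ℕ) → Fin n → BEdge n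
root-edge (suc n) fzero    = bridge
root-edge (suc n) (fsuc i) = inL (root-edge n i)

root-edge-down : ∀ n (i : Fin n) → Down (root-edge n i) (root n) (child (root-edge n i))
root-edge-down (suc n) fzero    = refl , refl
root-edge-down (suc n) (fsuc i) = cong inj₁ (proj₁ (root-edge-down n i)) , refl

root-edge-injective : ∀ n {i j : Fin n} → root-edge n i ≡ root-edge n j → i ≡ j
root-edge-injective (suc n) {fzero}  {fzero}  _    = refl
root-edge-injective (suc n) {fsuc i} {fsuc j} p    = cong fsuc (root-edge-injective n (inL-injective p))
  where
  inL-injective : ∀ {m} {e e′ : BEdge m} → inL e ≡ inL e′ → e ≡ e′
  inL-injective refl = refl
root-edge-injective (suc n) {fzero}  {fsuc j} ()
root-edge-injective (suc n) {fsuc i} {fzero}  ()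

root-children-distinct : ∀ n {i j : Fin n} → i ≢ j → child (root-edge n i) ≢ child (root-edge n j)
root-children-distinct n i≢j p = i≢j (root-edge-injective n (child-injective p))

-- Two edges of the same colour never form a conflict-free path: every colour
-- occurs on both of them or on neither.
monochromatic-pair-conflicted : ∀ {n c} (col : BEdge n → Fin c) {e₁ e₂ : BEdge n} →
  col e₁ ≡ col e₂ → ¬ ConflictFree col (e₁ ∷ e₂ ∷ [])
monochromatic-pair-conflicted col {e₁} {e₂} same (a , once) with col e₁ ≟F a
... | yes p₁ with col e₂ ≟F a
...   | yes _   = contradiction once λ ()
...   | no ¬p₂  = ¬p₂ (trans (sym same) p₁)
monochromatic-pair-conflicted col {e₁} {e₂} same (a , once) | no ¬p₁ with col e₂ ≟F a
...   | yes p₂  = ¬p₁ (trans same p₂)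
...   | no _    = contradiction once λ ()

-- In a conflict-free colouring the root edges get pairwise distinct colours,
-- since the path between their children consists of exactly these two edges.
root-edges-distinct-colours : ∀ {n c} (col : BEdge n → Fin c) → IsCFCColoring col →
  ∀ {i j} → col (root-edge n i) ≡ col (root-edge n j) → i ≡ j
root-edges-distinct-colours {n} col cfc {i} {j} same with i ≟F j
... | yes i≡j = i≡j
... | no  i≢j with cfc (child (root-edge n i)) (child (root-edge n j)) (root-children-distinct n i≢j)
...   | es , (vs , walk , uniq) , conflict-free = ⊥-elim (
  monochromatic-pair-conflicted col same (subst (ConflictFree col)
    (path-between-root-children (root-edge-down n i) (root-edge-down n j)
       (root-children-distinct n i≢j) walk uniq) conflict-free))

cfc-lower-bound : ∀ n c → CFCColorable n c → n ≤ c
cfc-lower-bound n c (col , cfc) = injective⇒≤ (root-edges-distinct-colours col cfc)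

-- Paths inside and across the two copies

data Copy : Set where
  first second : Copy

opposite : Copy → Copy
opposite first  = second
opposite second = first

vertex-in : ∀ {n} → Copy → BVert n → BVert (suc n)
vertex-in first  = inj₁
vertex-in second = inj₂

edge-in : ∀ {n} → Copy → BEdge n → BEdge (suc n)
edge-in first  = inL
edge-in second = inR

vertex-in-injective : ∀ {n} s {x y : BVert n} → vertex-in s x ≡ vertex-in s y → x ≡ y
vertex-in-injective first  = inj₁-injective
vertex-in-injective second = inj₂-injective

copies-disjoint : ∀ {n} s (x y : BVert n) → vertex-in s x ≢ vertex-in (opposite s) y
copies-disjoint first  _ _ ()
copies-disjoint second _ _ ()

bridge-joins : ∀ {n} s → Joins bridge (vertex-in {n} s (root n)) (vertex-in (opposite s) (root n))
bridge-joins first  = fwd refl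
bridge-joins second = bwd refl

lift-walk : ∀ {n} s {x y : BVert n} {vs es} → IsWalk x vs es y →
  IsWalk (vertex-in s x) (map (vertex-in s) vs) (map (edge-in s) es) (vertex-in s y)
lift-walk s stop         = stop
lift-walk s (step e j w) = step (edge-in s e) (lift-joins s j) (lift-walk s w)
  where
  lift-joins : ∀ s {e : BEdge _} {x z} → Joins e x z →
               Joins (edge-in s e) (vertex-in s x) (vertex-in s z)
  lift-joins first  (fwd p) = fwd (cong (Product.map inj₁ inj₁) p)
  lift-joins first  (bwd p) = bwd (cong (Product.map inj₁ inj₁) p)
  lift-joins second (fwd p) = fwd (cong (Product.map inj₂ inj₂) p)
  lift-joins second (bwd p) = bwd (cong (Product.map inj₂ inj₂) p)

lift-path : ∀ {n} s {x y : BVert n} {es} → IsPath x es y →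
  IsPath (vertex-in s x) (map (edge-in s) es) (vertex-in s y)
lift-path s (vs , walk , uniq) =
  map (vertex-in s) vs , lift-walk s walk , Unique.map⁺ (vertex-in-injective s) uniq

walk-++ : ∀ {n} {x y z : BVert n} {vs es ws fs} → IsWalk x vs es y → IsWalk y ws fs z →
  IsWalk x (vs ++ ws) (es ++ fs) z
walk-++ stop         w′ = w′
walk-++ (step e j w) w′ = step e j (walk-++ w w′)

-- A path x → root in one copy, the bridge, and a path root → y in the other
-- copy form a path of B_{n+2}: the two halves live in disjoint copies.
crossing-path : ∀ {n} s {x y : BVert n} {es₁ es₂} →
  IsPath x es₁ (root n) → IsPath (root n) es₂ y →
  IsPath (vertex-in s x) (map (edge-in s) es₁ ++ bridge ∷ map (edge-in (opposite s)) es₂)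
         (vertex-in (opposite s) y)
crossing-path s (vs₁ , walk₁ , uniq₁) (vs₂ , walk₂ , uniq₂) =
  map (vertex-in s) vs₁ ++ map (vertex-in (opposite s)) (_ ∷ vs₂) ,
  walk-++ (lift-walk s walk₁) (step bridge (bridge-joins s) (lift-walk (opposite s) walk₂)) ,
  Unique.++⁺ (Unique.map⁺ (vertex-in-injective s) uniq₁)
             (Unique.map⁺ (vertex-in-injective (opposite s)) uniq₂)
             separated
  where
  separated : Disjoint (map (vertex-in s) (_ ∷ vs₁)) (map (vertex-in (opposite s)) (_ ∷ vs₂))
  separated (v∈₁ , v∈₂) with ∈-map⁻ (vertex-in s) v∈₁ | ∈-map⁻ (vertex-in (opposite s)) v∈₂
  ... | a , _ , refl | b , _ , v≡b = copies-disjoint s a b v≡b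

empty-path : ∀ {n} (x : BVert n) → IsPath x [] x
empty-path x = [] , stop , [] ∷ []

PathTo PathFrom : ∀ {n} → BVert n → Set
PathTo   {n} x = Σ (List (BEdge n)) λ es → IsPath x es (root n)
PathFrom {n} y = Σ (List (BEdge n)) λ es → IsPath (root n) es y

path-to-root : ∀ {n} (x : BVert n) → PathTo x
path-to-root {zero}  tt       = [] , empty-path tt
path-to-root {suc n} (inj₁ x) with path-to-root x
... | es , path = map inL es , lift-path first path
path-to-root {suc n} (inj₂ x) with path-to-root x
... | es , path = _ , crossing-path second path (empty-path (root n))

path-from-root : ∀ {n} (y : BVert n) → PathFrom y
path-from-root {zero}  tt       = [] , empty-path tt
path-from-root {suc n} (inj₁ y) with path-from-root y
... | es , path = map inL es , lift-path first path
path-from-root {suc n} (inj₂ y) with path-from-root y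
... | es , path = _ , crossing-path first (empty-path (root n)) path

countColor-++ : ∀ {n c} (col : BEdge n → Fin c) a (xs ys : List (BEdge n)) →
  countColor col a (xs ++ ys) ≡ countColor col a xs + countColor col a ys
countColor-++ col a xs ys = trans (cong length (filter-++ (λ e → col e ≟F a) xs ys))
                                  (length-++ (filter (λ e → col e ≟F a) xs))

countColor-single : ∀ {n c} (col : BEdge n → Fin c) {a} {e} →
  col e ≡ a → countColor col a (e ∷ []) ≡ 1
countColor-single col {a} p = cong length (filter-accept (λ e → col e ≟F a) p)

countColor-absent : ∀ {n c} (col : BEdge n → Fin c) {a} {es} →
  All (λ e → col e ≢ a) es → countColor col a es ≡ 0
countColor-absent col {a} none = cong length (filter-none (λ e → col e ≟F a) none)

countColor-recolour : ∀ {n m c d} (col : BEdge n → Fin c) (col′ : BEdge m → Fin d)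
  (f : BEdge n → BEdge m) (g : Fin c → Fin d) → (∀ {i j} → g i ≡ g j → i ≡ j) →
  (∀ e → col′ (f e) ≡ g (col e)) →
  ∀ a es → countColor col′ (g a) (map f es) ≡ countColor col a es
countColor-recolour col col′ f g g-inj compat a [] = refl
countColor-recolour col col′ f g g-inj compat a (e ∷ es)
  with col′ (f e) ≟F g a | col e ≟F a
... | yes _ | yes _ = cong suc (countColor-recolour col col′ f g g-inj compat a es)
... | no _  | no _  = countColor-recolour col col′ f g g-inj compat a es
... | yes p | no ¬q = contradiction (g-inj (trans (sym (compat e)) p)) ¬q
... | no ¬p | yes q = contradiction (trans (compat e) (cong g q)) ¬p

-- Upper bound

level : ∀ {n} → BEdge n → Fin n
level (inL e)         = inject₁ (level e)
level (inR e)         = inject₁ (level e)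
level {suc n} bridge  = fromℕ n

level-edge-in : ∀ {n} s (e : BEdge n) → level (edge-in s e) ≡ inject₁ (level e)
level-edge-in first  e = refl
level-edge-in second e = refl

top-colour-only-on-bridge : ∀ {n} s (e : BEdge n) → level (edge-in s e) ≢ fromℕ n
top-colour-only-on-bridge s e p = fromℕ≢inject₁ (sym (trans (sym (level-edge-in s e)) p))

ConflictFreePath : ∀ {n c} → (BEdge n → Fin c) → BVert n → BVert n → Set
ConflictFreePath {n} col x y = Σ (List (BEdge n)) λ es → IsPath x es y × ConflictFree col es

-- Two vertices in the same copy: lift a conflict-free path of the copy; its
-- uniquely occurring colour i stays unique as inject₁ i.
within-copy : ∀ {n} → IsCFCColoring (level {n}) →
  ∀ s {a b : BVert n} → a ≢ b → ConflictFreePath level (vertex-in s a) (vertex-in s b)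
within-copy cfc s {a} {b} a≢b with cfc a b a≢b
... | es , path , (i , once) = map (edge-in s) es , lift-path s path , inject₁ i ,
  trans (countColor-recolour level level (edge-in s) inject₁ inject₁-injective
           (level-edge-in s) i es) once

-- Two vertices in different copies: go up to the root, cross the bridge and
-- go down again; the bridge is the only edge of colour n.
across-copies : ∀ {n} s (a b : BVert n) →
  ConflictFreePath level (vertex-in s a) (vertex-in (opposite s) b)
across-copies {n} s a b with path-to-root a | path-from-root b
... | es₁ , path₁ | es₂ , path₂ = _ , crossing-path s path₁ path₂ , fromℕ n , bridge-once
  where
  open ≡-Reasoning
  count : List (BEdge (suc n)) → ℕ
  count = countColor level (fromℕ n)
  absent : ∀ s′ es → count (map (edge-in s′) es) ≡ 0
  absent s′ es = countColor-absent level (All-map⁺ (universal (top-colour-only-on-bridge s′) es))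
  bridge-once : count (map (edge-in s) es₁ ++ bridge ∷ map (edge-in (opposite s)) es₂) ≡ 1
  bridge-once = begin
    count (map (edge-in s) es₁ ++ bridge ∷ map (edge-in (opposite s)) es₂)
      ≡⟨ countColor-++ level (fromℕ n) (map (edge-in s) es₁) _ ⟩
    count (map (edge-in s) es₁) + count (bridge ∷ map (edge-in (opposite s)) es₂)
      ≡⟨ cong₂ _+_ (absent s es₁) (countColor-++ level (fromℕ n) (bridge ∷ []) _) ⟩
    0 + (count (bridge ∷ []) + count (map (edge-in (opposite s)) es₂))
      ≡⟨ cong₂ _+_ (countColor-single level {e = bridge {n}} refl) (absent (opposite s) es₂) ⟩
    1 + 0
      ∎

levelled-colouring-cfc : ∀ n → IsCFCColoring (level {n})
levelled-colouring-cfc zero    tt       tt       tt≢tt = ⊥-elim (tt≢tt refl)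
levelled-colouring-cfc (suc n) (inj₁ a) (inj₁ b) a≢b =
  within-copy (levelled-colouring-cfc n) first (a≢b ∘′ cong inj₁)
levelled-colouring-cfc (suc n) (inj₂ a) (inj₂ b) a≢b =
  within-copy (levelled-colouring-cfc n) second (a≢b ∘′ cong inj₂)
levelled-colouring-cfc (suc n) (inj₁ a) (inj₂ b) _   = across-copies first a b
levelled-colouring-cfc (suc n) (inj₂ a) (inj₁ b) _   = across-copies second a b

theorem3p5 : (k : ℕ) → k ≥ 2 → CfcEq (k ∸ 1) (k ∸ 1)
theorem3p5 k _ = (level , levelled-colouring-cfc (k ∸ 1)) , cfc-lower-bound (k ∸ 1)
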